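{- Let $\mathsf M$ be an oriented matroid and let $\mathcal Q$ be its tope-pairs poset (defined in the context). Define $\rho:\mathcal Q\to\mathcal Q$ by $\rho(R,T)=(-T,R)$. Then the assignment $n\mapsto\rho^n$ defines an action of $\mathbb Z_4$ on the order complex $\Delta(\mathcal Q)$ by simplicial automorphisms, and hence a simplicial action of $\mathbb Z_4$ on the complex $|\mathcal Q|$.
   Context: $\mathsf M$ is an oriented matroid on a finite ground set $E$. Its covectors lie in $\{+,0,-\}^E$, and its topes are the maximal covectors; $\mathcal T$ denotes the set of topes. For sign vectors $X,Y$, the separating set is $S(X,Y)=\{f\in E\mid X_f=-Y_f\neq0\}$. For $B\in\mathcal T$, write $T\le_B R$ iff $S(B,T)\subseteq S(B,R)$. The tope-pairs poset is $\mathcal Q=\mathcal T\times\mathcal T$ with $(T,R)\le(T',R')$ iff $T\le_{T'}R\le_{T'}R'$. The order complex $\Delta(P)$ of a poset $P$ is the simplicial complex of finite chains of $P$. $|P|$ is its geometric realization. $P^{op}$ denotes the opposite poset; note that $\Delta(P)=\Delta(P^{op})$. -}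

module Defs where

open import Data.Nat using (ℕ; zero; suc)
open import Data.Nat.DivMod using (_mod_)
open import Data.Fin using (Fin; toℕ)
open import Data.Vec using (Vec; map; zipWith; lookup; replicate)
open import Data.Product using (Σ; _×_; _,_; ∃)
open import Data.Sum using (_⊎_)
open import Data.Empty using (⊥)
open import Data.List using (List)
import Data.List as List
open import Data.List.Relation.Unary.All using (All)
open import Data.List.Relation.Unary.AllPairs using (AllPairs)
open import Relation.Nullary using (¬_)
open import Relation.Binary.PropositionalEquality using (_≡_)
open import Function using (id; _∘_)

data Sign : Set where
  ⊕ ⊖ ⊙ : Sign      -- +, -, 0

neg : Sign → Sign
neg ⊕ = ⊖
neg ⊖ = ⊕
neg ⊙ = ⊙

compose : Sign → Sign → Sign
compose ⊙ y = y
compose x y = x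

SignVec : ℕ → Set
SignVec n = Vec Sign n

negV : ∀ {n} → SignVec n → SignVec n
negV = map neg

_∘ₛ_ : ∀ {n} → SignVec n → SignVec n → SignVec n
_∘ₛ_ = zipWith compose

zeroV : ∀ {n} → SignVec n
zeroV = replicate _ ⊙

Sep : ∀ {n} → SignVec n → SignVec n → Fin n → Set
Sep X Y e = (lookup X e ≡ neg (lookup Y e)) × ¬ (lookup X e ≡ ⊙)

_≼_ : ∀ {n} → SignVec n → SignVec n → Set
X ≼ Y = ∀ e → (lookup X e ≡ ⊙) ⊎ (lookup X e ≡ lookup Y e)

record OrientedMatroid (n : ℕ) : Set₁ where
  field
    Covector : SignVec n → Set
    cov-zero : Covector zeroV
    cov-neg  : ∀ {X} → Covector X → Covector (negV X)
    cov-comp : ∀ {X Y} → Covector X → Covector Y → Covector (X ∘ₛ Y)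
    cov-elim : ∀ {X Y} → Covector X → Covector Y → ∀ e → Sep X Y e →
               Σ (SignVec n) λ Z → Covector Z × (lookup Z e ≡ ⊙) ×
                 (∀ f → ¬ Sep X Y f → lookup Z f ≡ lookup (X ∘ₛ Y) f)

open OrientedMatroid public

IsTope : ∀ {n} → OrientedMatroid n → SignVec n → Set
IsTope M T = Covector M T × (∀ X → Covector M X → T ≼ X → X ≡ T)

_≤[_]_ : ∀ {n} → SignVec n → SignVec n → SignVec n → Set
T ≤[ B ] R = ∀ e → Sep B T e → Sep B R e

Pair : ℕ → Set
Pair n = SignVec n × SignVec n

IsQ : ∀ {n} → OrientedMatroid n → Pair n → Set
IsQ M (T , R) = IsTope M T × IsTope M R

_≤Q_ : ∀ {n} → Pair n → Pair n → Set
(T , R) ≤Q (T' , R') = (T ≤[ T' ] R) × (R ≤[ T' ] R')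

Comparable : ∀ {n} → Pair n → Pair n → Set
Comparable p q = (p ≤Q q) ⊎ (q ≤Q p)

-- Simplices of the order complex Δ(Q): finite chains of Q,
-- represented by lists of elements of Q that are pairwise comparable.
IsChain : ∀ {n} → OrientedMatroid n → List (Pair n) → Set
IsChain M c = All (IsQ M) c × AllPairs Comparable c

-- a simplicial automorphism of Δ(Q): a bijection of the vertex set Q
-- such that it and its inverse map simplices (chains) to simplices.
SimplicialAut : ∀ {n} → OrientedMatroid n → (Pair n → Pair n) → Set
SimplicialAut M f =
  (∀ q → IsQ M q → IsQ M (f q)) ×
  Σ (Pair _ → Pair _) λ g →
    (∀ q → IsQ M q → IsQ M (g q)) ×
    (∀ q → IsQ M q → g (f q) ≡ q) ×
    (∀ q → IsQ M q → f (g q) ≡ q) ×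
    (∀ c → IsChain M c → IsChain M (List.map f c)) ×
    (∀ c → IsChain M c → IsChain M (List.map g c))

ρ : ∀ {n} → Pair n → Pair n
ρ (R , T) = (negV T , R)

iter : ∀ {A : Set} → ℕ → (A → A) → A → A
iter zero    f = id
iter (suc k) f = f ∘ iter k f

Z4 : Set
Z4 = Fin 4

_+₄_ : Z4 → Z4 → Z4
k +₄ l = (toℕ k Data.Nat.+ toℕ l) mod 4
  where import Data.Nat

IsSimplicialZ4Action : ∀ {n} → OrientedMatroid n → (Z4 → Pair n → Pair n) → Set
IsSimplicialZ4Action M act =
  (∀ q → IsQ M q → act (Data.Fin.zero) q ≡ q) ×
  (∀ k l q → IsQ M q → act (k +₄ l) q ≡ act k (act l q)) ×
  (∀ k → SimplicialAut M (act k))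
  where import Data.Fin

-- If both entries of p ≤ q are topes, then ρ q ≤ ρ p: the two required
-- inclusions of separating sets are checked coordinatewise, using only the hypotheses on p ≤ q
-- and the fact that all topes of an oriented matroid have the same support (T ∘ Y is a covector
-- above the tope T, so equals T). Hence ρ reverses the order of 𝒬, so it and its powers map
-- chains to chains, and ρ⁴ = id because negation is an involution; n ↦ ρⁿ therefore factors
-- through ℤ/4.
module Submission where

open import Defs
open import Data.Nat using (ℕ; zero; suc; _+_; _*_; _/_; _%_; NonZero)
open import Data.Nat.DivMod using (m≡m%n+[m/n]*n)
open import Data.Nat.Properties using (*-suc; +-comm)
open import Data.Fin using (toℕ)
open import Data.Fin.Properties using (toℕ-fromℕ<)
open import Data.Vec using (lookup)
open import Data.Vec.Properties using (lookup-map; lookup-zipWith; map-∘; map-cong; map-id)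
open import Data.Product using (_×_; _,_; proj₁)
open import Data.Sum using (_⊎_; inj₁; inj₂; swap)
import Data.Sum as Sum
open import Data.Empty using (⊥-elim)
import Data.List as List
open import Data.List.Relation.Unary.All using (All; []; _∷_)
import Data.List.Relation.Unary.All as All
import Data.List.Relation.Unary.All.Properties as All
open import Data.List.Relation.Unary.AllPairs using (AllPairs; []; _∷_)
open import Relation.Nullary using (¬_)
open import Relation.Binary.PropositionalEquality
open ≡-Reasoning

neg-involutive : ∀ x → neg (neg x) ≡ x
neg-involutive ⊕ = refl
neg-involutive ⊖ = refl
neg-involutive ⊙ = refl

negV-involutive : ∀ {n} (X : SignVec n) → negV (negV X) ≡ X
negV-involutive X = trans (sym (map-∘ neg neg X)) (trans (map-cong neg-involutive X) (map-id X))

data Opposite : Sign → Sign → Set where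
  ⊕⊖ : Opposite ⊕ ⊖
  ⊖⊕ : Opposite ⊖ ⊕

opposite-irrefl : ∀ {x} → ¬ Opposite x x
opposite-irrefl ()

neg-opposite : ∀ {x y} → Opposite (neg x) (neg y) → Opposite x y
neg-opposite {⊕} {⊖} ⊖⊕ = ⊕⊖
neg-opposite {⊖} {⊕} ⊕⊖ = ⊖⊕
neg-opposite {⊕} {⊕} ()
neg-opposite {⊕} {⊙} ()
neg-opposite {⊖} {⊖} ()
neg-opposite {⊖} {⊙} ()
neg-opposite {⊙} ()

sep⇒opposite : ∀ x y → (x ≡ neg y) × ¬ (x ≡ ⊙) → Opposite x y
sep⇒opposite ⊕ ⊖ _ = ⊕⊖
sep⇒opposite ⊖ ⊕ _ = ⊖⊕
sep⇒opposite ⊕ ⊕ (() , _)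
sep⇒opposite ⊕ ⊙ (() , _)
sep⇒opposite ⊖ ⊖ (() , _)
sep⇒opposite ⊖ ⊙ (() , _)
sep⇒opposite ⊙ _ (_ , x≢⊙) = ⊥-elim (x≢⊙ refl)

opposite⇒sep : ∀ {x y} → Opposite x y → (x ≡ neg y) × ¬ (x ≡ ⊙)
opposite⇒sep ⊕⊖ = refl , λ ()
opposite⇒sep ⊖⊕ = refl , λ ()

-- The two coordinates of ρ q ≤ ρ p; without the support hypothesis a zero entry of t′ (resp. t)
-- would be a counterexample.
reverse-outer : ∀ {t′ r r′} → (t′ ≡ ⊙ → r ≡ ⊙) → (Opposite t′ r → Opposite t′ r′) →
                Opposite r r′ → Opposite (neg r) t′
reverse-outer {⊕} _ _ ⊕⊖ = ⊖⊕
reverse-outer {⊖} _ t′r⇒t′r′ ⊕⊖ = ⊥-elim (opposite-irrefl (t′r⇒t′r′ ⊖⊕))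
reverse-outer {⊙} t′≡⊙⇒r≡⊙ _ ⊕⊖ with () ← t′≡⊙⇒r≡⊙ refl
reverse-outer {⊕} _ t′r⇒t′r′ ⊖⊕ = ⊥-elim (opposite-irrefl (t′r⇒t′r′ ⊕⊖))
reverse-outer {⊖} _ _ ⊖⊕ = ⊕⊖
reverse-outer {⊙} t′≡⊙⇒r≡⊙ _ ⊖⊕ with () ← t′≡⊙⇒r≡⊙ refl

reverse-inner : ∀ {t t′ r} → (t ≡ ⊙ → r ≡ ⊙) → (Opposite t′ t → Opposite t′ r) →
                Opposite (neg r) t′ → Opposite (neg r) t
reverse-inner {⊕} {r = ⊕} _ _ ⊖⊕ = ⊖⊕
reverse-inner {⊖} {r = ⊕} _ t′t⇒t′r ⊖⊕ = ⊥-elim (opposite-irrefl (t′t⇒t′r ⊕⊖))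
reverse-inner {⊙} {r = ⊕} t≡⊙⇒r≡⊙ _ ⊖⊕ with () ← t≡⊙⇒r≡⊙ refl
reverse-inner {⊕} {r = ⊖} _ t′t⇒t′r ⊕⊖ = ⊥-elim (opposite-irrefl (t′t⇒t′r ⊖⊕))
reverse-inner {⊖} {r = ⊖} _ _ ⊕⊖ = ⊕⊖
reverse-inner {⊙} {r = ⊖} t≡⊙⇒r≡⊙ _ ⊕⊖ with () ← t≡⊙⇒r≡⊙ refl
reverse-inner {r = ⊙} _ _ ()

module _ {n : ℕ} where

  Sep⇒Opposite : ∀ (X Y : SignVec n) e → Sep X Y e → Opposite (lookup X e) (lookup Y e)
  Sep⇒Opposite X Y e = sep⇒opposite (lookup X e) (lookup Y e)

  Opposite⇒Sep : ∀ (X Y : SignVec n) e → Opposite (lookup X e) (lookup Y e) → Sep X Y e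
  Opposite⇒Sep X Y e = opposite⇒sep

  lookup-negV : ∀ (X : SignVec n) e → lookup (negV X) e ≡ neg (lookup X e)
  lookup-negV X e = lookup-map e neg X

  _⊆ₛ_ : SignVec n → SignVec n → Set
  X ⊆ₛ Y = ∀ e → lookup Y e ≡ ⊙ → lookup X e ≡ ⊙

  ≼-∘ₛ : ∀ (X Y : SignVec n) → X ≼ (X ∘ₛ Y)
  ≼-∘ₛ X Y e rewrite lookup-zipWith compose e X Y = conformal (lookup X e)
    where
    conformal : ∀ x → (x ≡ ⊙) ⊎ (x ≡ compose x (lookup Y e))
    conformal ⊕ = inj₂ refl
    conformal ⊖ = inj₂ refl
    conformal ⊙ = inj₁ refl

  ≼-negV : ∀ {X Y : SignVec n} → X ≼ Y → negV X ≼ negV Y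
  ≼-negV {X} {Y} X≼Y e =
    subst₂ (λ x y → (x ≡ ⊙) ⊎ (x ≡ y)) (sym (lookup-negV X e)) (sym (lookup-negV Y e))
      (Sum.map (cong neg) (cong neg) (X≼Y e))

  ρ-antitone : ∀ {T R T′ R′ : SignVec n} → R ⊆ₛ T → R ⊆ₛ T′ →
               (T , R) ≤Q (T′ , R′) → ρ (T′ , R′) ≤Q ρ (T , R)
  ρ-antitone {T} {R} {T′} {R′} R⊆T R⊆T′ (T≤R , R≤R′) = R′≤T′ , T′≤T
    where
    fromNegˡ : ∀ Y e → Sep (negV R) Y e → Opposite (neg (lookup R e)) (lookup Y e)
    fromNegˡ Y e s =
      subst (λ x → Opposite x (lookup Y e)) (lookup-negV R e) (Sep⇒Opposite (negV R) Y e s)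

    toNegˡ : ∀ Y e → Opposite (neg (lookup R e)) (lookup Y e) → Sep (negV R) Y e
    toNegˡ Y e o =
      Opposite⇒Sep (negV R) Y e (subst (λ x → Opposite x (lookup Y e)) (sym (lookup-negV R e)) o)

    R′≤T′ : negV R′ ≤[ negV R ] T′
    R′≤T′ e s = toNegˡ T′ e (reverse-outer (R⊆T′ e)
      (λ o → Sep⇒Opposite T′ R′ e (R≤R′ e (Opposite⇒Sep T′ R e o)))
      (neg-opposite (subst (Opposite _) (lookup-negV R′ e) (fromNegˡ (negV R′) e s))))

    T′≤T : T′ ≤[ negV R ] T
    T′≤T e s = toNegˡ T e (reverse-inner (R⊆T e)
      (λ o → Sep⇒Opposite T′ R e (T≤R e (Opposite⇒Sep T′ T e o)))
      (fromNegˡ T′ e s))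

module _ {n : ℕ} (M : OrientedMatroid n) where

  covector-⊆ₛ-tope : ∀ {T Y} → IsTope M T → Covector M Y → Y ⊆ₛ T
  covector-⊆ₛ-tope {T} {Y} (covT , maximal) covY e Tₑ≡⊙ = begin
    lookup Y e                         ≡⟨ cong (λ x → compose x (lookup Y e)) Tₑ≡⊙ ⟨
    compose (lookup T e) (lookup Y e)  ≡⟨ lookup-zipWith compose e T Y ⟨
    lookup (T ∘ₛ Y) e                  ≡⟨ cong (λ Z → lookup Z e) T∘Y≡T ⟩
    lookup T e                         ≡⟨ Tₑ≡⊙ ⟩
    ⊙                                  ∎
    where
    T∘Y≡T : T ∘ₛ Y ≡ T
    T∘Y≡T = maximal (T ∘ₛ Y) (cov-comp M covT covY) (≼-∘ₛ T Y)

  tope-negV : ∀ {T} → IsTope M T → IsTope M (negV T)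
  tope-negV {T} (covT , maximal) = cov-neg M covT , maximal⁻
    where
    maximal⁻ : ∀ X → Covector M X → negV T ≼ X → X ≡ negV T
    maximal⁻ X covX -T≼X = begin
      X               ≡⟨ negV-involutive X ⟨
      negV (negV X)   ≡⟨ cong negV (maximal (negV X) (cov-neg M covX) T≼-X) ⟩
      negV T          ∎
      where
      T≼-X : T ≼ negV X
      T≼-X = subst (_≼ negV X) (negV-involutive T) (≼-negV {X = negV T} {Y = X} -T≼X)

  ρ-IsQ : ∀ {q} → IsQ M q → IsQ M (ρ q)
  ρ-IsQ (tR , tT) = tope-negV tT , tR

  ρ-antitoneQ : ∀ {p q} → IsQ M p → IsQ M q → p ≤Q q → ρ q ≤Q ρ p
  ρ-antitoneQ {T , R} {T′ , R′} (tT , tR) (tT′ , _) =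
    ρ-antitone {T = T} {R} {T′} {R′}
      (covector-⊆ₛ-tope tT (proj₁ tR)) (covector-⊆ₛ-tope tT′ (proj₁ tR))

  SimplicialMap : (Pair n → Pair n) → Set
  SimplicialMap f = (∀ {q} → IsQ M q → IsQ M (f q)) ×
                    (∀ {p q} → IsQ M p → IsQ M q → Comparable p q → Comparable (f p) (f q))

  ρ-simplicial : SimplicialMap ρ
  ρ-simplicial = ρ-IsQ , λ Qp Qq p~q →
    swap (Sum.map (ρ-antitoneQ Qp Qq) (ρ-antitoneQ Qq Qp) p~q)

  iter-simplicial : ∀ {f} → SimplicialMap f → ∀ m → SimplicialMap (iter m f)
  iter-simplicial _ zero = (λ Qq → Qq) , (λ _ _ p~q → p~q)
  iter-simplicial f@(fQ , f~) (suc m) with iter-simplicial f m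
  ... | fᵐQ , fᵐ~ = (λ Qq → fQ (fᵐQ Qq)) , λ Qp Qq p~q → f~ (fᵐQ Qp) (fᵐQ Qq) (fᵐ~ Qp Qq p~q)

  simplicial-chain : ∀ {f} → SimplicialMap f → ∀ c → IsChain M c → IsChain M (List.map f c)
  simplicial-chain {f} (fQ , f~) c (Qc , chain) = All.map⁺ (All.map fQ Qc) , mapPairs Qc chain
    where
    mapPairs : ∀ {c} → All (IsQ M) c → AllPairs Comparable c → AllPairs Comparable (List.map f c)
    mapPairs [] [] = []
    mapPairs (Qp ∷ Qc) (p~c ∷ chain) =
      All.map⁺ (All.zipWith (λ (Qq , p~q) → f~ Qp Qq p~q) (Qc , p~c)) ∷ mapPairs Qc chain

  simplicial-aut : ∀ {f g} → SimplicialMap f → SimplicialMap g →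
                   (∀ q → g (f q) ≡ q) → (∀ q → f (g q) ≡ q) → SimplicialAut M f
  simplicial-aut {g = g} sf@(fQ , _) sg@(gQ , _) gf≡id fg≡id =
    (λ _ → fQ) , g , (λ _ → gQ) , (λ q _ → gf≡id q) , (λ q _ → fg≡id q) ,
    simplicial-chain sf , simplicial-chain sg

module _ {A : Set} (f : A → A) where

  iter-+ : ∀ m k x → iter (m + k) f x ≡ iter m f (iter k f x)
  iter-+ zero    k x = refl
  iter-+ (suc m) k x = cong f (iter-+ m k x)

  module _ {p : ℕ} (fᵖ≡id : ∀ x → iter p f x ≡ x) where

    iter-*-period : ∀ m x → iter (m * p) f x ≡ x
    iter-*-period zero    x = refl
    iter-*-period (suc m) x = begin
      iter (p + m * p) f x        ≡⟨ iter-+ p (m * p) x ⟩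
      iter p f (iter (m * p) f x) ≡⟨ cong (iter p f) (iter-*-period m x) ⟩
      iter p f x                  ≡⟨ fᵖ≡id x ⟩
      x                           ∎

    iter-% : .{{_ : NonZero p}} → ∀ m x → iter (m % p) f x ≡ iter m f x
    iter-% m x = begin
      iter (m % p) f x                      ≡⟨ cong (iter (m % p) f) (iter-*-period (m / p) x) ⟨
      iter (m % p) f (iter (m / p * p) f x) ≡⟨ iter-+ (m % p) (m / p * p) x ⟨
      iter (m % p + m / p * p) f x          ≡⟨ cong (λ k → iter k f x) (m≡m%n+[m/n]*n m p) ⟨
      iter m f x                            ∎

ρ⁴≡id : ∀ {n} (q : Pair n) → iter 4 ρ q ≡ q
ρ⁴≡id (R , T) = cong₂ _,_ (negV-involutive R) (negV-involutive T)

-- ρ^(3m) is the inverse of ρ^m.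
ρ-power-aut : ∀ {n} (M : OrientedMatroid n) m → SimplicialAut M (iter m ρ)
ρ-power-aut M m = simplicial-aut M (ρᵏ-simplicial m) (ρᵏ-simplicial (m * 3)) left right
  where
  ρᵏ-simplicial : ∀ k → SimplicialMap M (iter k ρ)
  ρᵏ-simplicial = iter-simplicial M (ρ-simplicial M)

  right : ∀ q → iter m ρ (iter (m * 3) ρ q) ≡ q
  right q = begin
    iter m ρ (iter (m * 3) ρ q) ≡⟨ iter-+ ρ m (m * 3) q ⟨
    iter (m + m * 3) ρ q        ≡⟨ cong (λ k → iter k ρ q) (*-suc m 3) ⟨
    iter (m * 4) ρ q            ≡⟨ iter-*-period ρ ρ⁴≡id m q ⟩
    q                           ∎

  left : ∀ q → iter (m * 3) ρ (iter m ρ q) ≡ q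
  left q = begin
    iter (m * 3) ρ (iter m ρ q) ≡⟨ iter-+ ρ (m * 3) m q ⟨
    iter (m * 3 + m) ρ q        ≡⟨ cong (λ k → iter k ρ q) (+-comm (m * 3) m) ⟩
    iter (m + m * 3) ρ q        ≡⟨ iter-+ ρ m (m * 3) q ⟩
    iter m ρ (iter (m * 3) ρ q) ≡⟨ right q ⟩
    q                           ∎

theorem3p15 : (n : ℕ) (M : OrientedMatroid n) →
    IsSimplicialZ4Action M (λ k → iter (toℕ k) ρ)
theorem3p15 n M = (λ _ _ → refl) , action , λ k → ρ-power-aut M (toℕ k)
  where
  action : ∀ k l q → IsQ M q → iter (toℕ (k +₄ l)) ρ q ≡ iter (toℕ k) ρ (iter (toℕ l) ρ q)
  action k l q _ = begin
    iter (toℕ (k +₄ l)) ρ q           ≡⟨ cong (λ m → iter m ρ q) (toℕ-fromℕ< {m = k+l % 4} _) ⟩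
    iter (k+l % 4) ρ q                ≡⟨ iter-% ρ ρ⁴≡id k+l q ⟩
    iter k+l ρ q                      ≡⟨ iter-+ ρ (toℕ k) (toℕ l) q ⟩
    iter (toℕ k) ρ (iter (toℕ l) ρ q) ∎
    where
    k+l : ℕ
    k+l = toℕ k + toℕ l
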